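{- Let $\mathcal{Q}$ be the commutative monoid with presentation \[\mathcal{Q}=\langle a,\,b,\,c_0,c_1,c_2,\ldots \mid a^2=1,\ \ b^{n+1}c_n=b^{2n+3}\ (n\ge 0),\ \ c_mc_n=b^{m+2}c_n\ (0\le m\le n)\rangle,\] and let $\mathcal{P}=\{a\}\cup\{b^{2m}: m\ge 1\}\cup\{b^mc_n : 0\le m\le n,\ m+n \text{ odd}\}\subseteq\mathcal{Q}$. Then the bipartite monoid $(\mathcal{Q},\mathcal{P})$ is reduced: for any two distinct elements $x\neq y$ of $\mathcal{Q}$ there exists $z\in\mathcal{Q}$ such that exactly one of $xz$, $yz$ lies in $\mathcal{P}$.
   Context: A bipartite monoid is a pair $(\mathcal{Q},\mathcal{P})$ where $\mathcal{Q}$ is a commutative monoid and $\mathcal{P}\subseteq\mathcal{Q}$. Elements $x,y\in\mathcal{Q}$ are distinguishable if there is $z\in\mathcal{Q}$ with exactly one of $xz,yz$ in $\mathcal{P}$; the bipartite monoid is reduced if every pair of distinct elements is distinguishable. -}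

module Defs where

open import Data.Nat using (ℕ; zero; suc; _+_; _*_; _≤_)
open import Data.List using (List; []; _∷_; _++_; replicate)
open import Data.Product using (Σ; _×_; _,_)
open import Data.Sum using (_⊎_)
open import Relation.Nullary using (¬_)
open import Relation.Binary.PropositionalEquality using (_≡_)

-- Generic notions for bipartite monoids, stated for a commutative monoid
-- given as a carrier with an equivalence _≈_ (setoid equality, since Agda
-- has no quotient types), a multiplication _∙_, and a subset P (predicate).

Distinguishable : {Q : Set} (_∙_ : Q → Q → Q) (P : Q → Set) → Q → Q → Set
Distinguishable {Q} _∙_ P x y =
  Σ Q λ z → (P (x ∙ z) × ¬ P (y ∙ z)) ⊎ (¬ P (x ∙ z) × P (y ∙ z))

Reduced : {Q : Set} (_≈_ : Q → Q → Set) (_∙_ : Q → Q → Q) (P : Q → Set) → Set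
Reduced {Q} _≈_ _∙_ P = (x y : Q) → ¬ (x ≈ y) → Distinguishable _∙_ P x y

data Gen : Set where
  a : Gen
  b : Gen
  c : ℕ → Gen

Word : Set
Word = List Gen

b^ : ℕ → Word
b^ k = replicate k b

-- The congruence on words generated by commutativity and the defining
-- relations; Q is Word modulo _≈Q_.
infix 4 _≈Q_
data _≈Q_ : Word → Word → Set where
  ≈refl  : ∀ {x} → x ≈Q x
  ≈sym   : ∀ {x y} → x ≈Q y → y ≈Q x
  ≈trans : ∀ {x y z} → x ≈Q y → y ≈Q z → x ≈Q z
  ≈cong  : ∀ {x x′ y y′} → x ≈Q x′ → y ≈Q y′ → (x ++ y) ≈Q (x′ ++ y′)
  ≈comm  : ∀ x y → (x ++ y) ≈Q (y ++ x)
  rel-a  : (a ∷ a ∷ []) ≈Q []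
  rel-b  : ∀ n → (b^ (suc n) ++ (c n ∷ [])) ≈Q b^ (2 * n + 3)
  rel-c  : ∀ m n → m ≤ n → (c m ∷ c n ∷ []) ≈Q (b^ (m + 2) ++ (c n ∷ []))

Odd : ℕ → Set
Odd k = Σ ℕ λ j → k ≡ suc (2 * j)

InP : Word → Set
InP x =
  (x ≈Q (a ∷ []))
  ⊎ (Σ ℕ λ m → (1 ≤ m) × (x ≈Q b^ (2 * m)))
  ⊎ (Σ ℕ λ m → Σ ℕ λ n → (m ≤ n) × Odd (m + n) × (x ≈Q (b^ m ++ (c n ∷ []))))

-- Every element of Q has a normal form a^e b^d or a^e b^m c n with m ≤ n, and it is
-- determined by the invariant (parity of the a's, degree, largest c-index), where the
-- index is forgotten once the degree exceeds 2n + 2, because then b^m c n = b^(m+n+2).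
-- Membership in P is a parity condition on this invariant.  Distinct normal forms are
-- separated by a single c p (after an a if both contain one): multiplying by c p either
-- keeps a c-part, and the product lies in P iff its degree is odd, or collapses to a
-- power of b, which lies in P iff its degree is even.
module Submission where

open import Defs
open import Data.Bool using (Bool; true; false; not; _xor_)
open import Data.Bool.Properties
  using (not-involutive; not-¬; not-distribˡ-xor; xor-assoc; xor-comm; xor-same; xor-identityʳ; xor-inverseˡ)
  renaming (_≟_ to _≟ᵇ_)
open import Data.Empty using (⊥-elim)
open import Data.List using ([]; _∷_; _++_)
open import Data.List.Properties using (++-assoc; ++-identityʳ)
open import Data.Nat using (ℕ; zero; suc; _+_; _*_; _∸_; _⊔_; _≤_; _<_; z≤n; s≤s; z<s; _≤?_)
open import Data.Nat.Properties
open import Data.Nat.Tactic.RingSolver using (solve-∀)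
open import Data.Product using (_×_; _,_)
open import Data.Sum using (_⊎_; inj₁; inj₂)
open import Data.Unit using (⊤; tt)
open import Function using (_∘_; case_of_)
open import Function.Bundles using (_⇔_; mk⇔; module Equivalence)
open import Level using (0ℓ)
open import Relation.Binary.Bundles using (Setoid)
open import Relation.Binary.Definitions using (tri<; tri≈; tri>)
open import Relation.Binary.PropositionalEquality
import Relation.Binary.Reasoning.Setoid as SetoidReasoning
open import Relation.Nullary using (¬_; yes; no)

≈Q-setoid : Setoid 0ℓ 0ℓ
≈Q-setoid = record
  { Carrier       = Word
  ; _≈_           = _≈Q_
  ; isEquivalence = record { refl = ≈refl ; sym = ≈sym ; trans = ≈trans }
  }

module ≈Q-Reasoning = SetoidReasoning ≈Q-setoid

≡⇒≈Q : ∀ {x y} → x ≡ y → x ≈Q y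
≡⇒≈Q refl = ≈refl

≈Q-congˡ : ∀ w {x y} → x ≈Q y → w ++ x ≈Q w ++ y
≈Q-congˡ w = ≈cong (≈refl {w})

≈Q-interchange : ∀ x y u v → (x ++ y) ++ (u ++ v) ≈Q (x ++ u) ++ (y ++ v)
≈Q-interchange x y u v = begin
  (x ++ y) ++ (u ++ v)  ≡⟨ ++-assoc x y (u ++ v) ⟩
  x ++ (y ++ (u ++ v))  ≡⟨ cong (x ++_) (++-assoc y u v) ⟨
  x ++ ((y ++ u) ++ v)  ≈⟨ ≈Q-congˡ x (≈cong (≈comm y u) (≈refl {v})) ⟩
  x ++ ((u ++ y) ++ v)  ≡⟨ cong (x ++_) (++-assoc u y v) ⟩
  x ++ (u ++ (y ++ v))  ≡⟨ ++-assoc x u (y ++ v) ⟨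
  (x ++ u) ++ (y ++ v)  ∎
  where open ≈Q-Reasoning

a^ : Bool → Word
a^ false = []
a^ true  = a ∷ []

a^-xor : ∀ e e′ → a^ e ++ a^ e′ ≈Q a^ (e xor e′)
a^-xor false e′    = ≈refl
a^-xor true  false = ≈refl
a^-xor true  true  = rel-a

b^-+ : ∀ i j → b^ (i + j) ≡ b^ i ++ b^ j
b^-+ zero    j = refl
b^-+ (suc i) j = cong (b ∷_) (b^-+ i j)

-- The c-part of a normal form is encoded by a number t: no c for t = 0, and c (t - 1) otherwise.
cTail : ℕ → Word
cTail zero    = []
cTail (suc n) = c n ∷ []

cWeight : ℕ → ℕ
cWeight zero    = 0
cWeight (suc n) = suc (suc n)

mono : Bool → ℕ → ℕ → Word
mono e i t = a^ e ++ (b^ i ++ cTail t)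

cTail-merge : ∀ {t t′} → t ≤ t′ → cTail t ++ cTail t′ ≈Q b^ (cWeight t) ++ cTail t′
cTail-merge {zero}              _         = ≈refl
cTail-merge {suc m} {suc n} (s≤s m≤n) =
  ≈trans (rel-c m n m≤n) (≡⇒≈Q (cong (λ k → b^ k ++ c n ∷ []) (+-comm m 2)))

mono-++ : ∀ e e′ i j {t t′} → t ≤ t′ →
  mono e i t ++ mono e′ j t′ ≈Q mono (e xor e′) (i + j + cWeight t) t′
mono-++ e e′ i j {t} {t′} t≤t′ = begin
  (a^ e ++ (b^ i ++ cTail t)) ++ (a^ e′ ++ (b^ j ++ cTail t′))
    ≈⟨ ≈Q-interchange (a^ e) _ (a^ e′) _ ⟩
  (a^ e ++ a^ e′) ++ ((b^ i ++ cTail t) ++ (b^ j ++ cTail t′))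
    ≈⟨ ≈cong (a^-xor e e′) (≈Q-interchange (b^ i) _ (b^ j) _) ⟩
  a^ (e xor e′) ++ ((b^ i ++ b^ j) ++ (cTail t ++ cTail t′))
    ≈⟨ ≈Q-congˡ (a^ (e xor e′)) (≈cong (≡⇒≈Q (sym (b^-+ i j))) (cTail-merge t≤t′)) ⟩
  a^ (e xor e′) ++ (b^ (i + j) ++ (b^ (cWeight t) ++ cTail t′))
    ≡⟨ cong (a^ (e xor e′) ++_) (++-assoc (b^ (i + j)) _ _) ⟨
  a^ (e xor e′) ++ ((b^ (i + j) ++ b^ (cWeight t)) ++ cTail t′)
    ≡⟨ cong (λ w → a^ (e xor e′) ++ (w ++ cTail t′)) (b^-+ (i + j) (cWeight t)) ⟨
  mono (e xor e′) (i + j + cWeight t) t′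
    ∎
  where open ≈Q-Reasoning

b^-c-absorb : ∀ {i n} → n < i → b^ i ++ c n ∷ [] ≈Q b^ (i + suc (suc n))
b^-c-absorb {n = n} n<i with m≤n⇒∃[o]m+o≡n n<i
... | o , refl = begin
  b^ (suc n + o) ++ c n ∷ []          ≡⟨ cong (λ k → b^ k ++ c n ∷ []) (+-comm (suc n) o) ⟩
  b^ (o + suc n) ++ c n ∷ []          ≡⟨ cong (_++ c n ∷ []) (b^-+ o (suc n)) ⟩
  (b^ o ++ b^ (suc n)) ++ c n ∷ []    ≡⟨ ++-assoc (b^ o) (b^ (suc n)) _ ⟩
  b^ o ++ (b^ (suc n) ++ c n ∷ [])    ≈⟨ ≈Q-congˡ (b^ o) (rel-b n) ⟩
  b^ o ++ b^ (2 * n + 3)              ≡⟨ b^-+ o (2 * n + 3) ⟨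
  b^ (o + (2 * n + 3))                ≡⟨ cong b^ (degree n o) ⟩
  b^ (suc n + o + suc (suc n))        ∎
  where
  open ≈Q-Reasoning
  degree : ∀ n o → o + (2 * n + 3) ≡ suc n + o + suc (suc n)
  degree = solve-∀

-- b has degree 1 and c n degree n + 2, which makes the relations homogeneous;
-- top is encoded as for cTail.
record Shape : Set where
  constructor ⟨_,_,_⟩
  field
    parity : Bool
    degree : ℕ
    top    : ℕ

infixl 7 _∙_
_∙_ : Shape → Shape → Shape
⟨ e , d , t ⟩ ∙ ⟨ e′ , d′ , t′ ⟩ = ⟨ e xor e′ , d + d′ , t ⊔ t′ ⟩

ε : Shape
ε = ⟨ false , 0 , 0 ⟩

∙-assoc : ∀ k l m → (k ∙ l) ∙ m ≡ k ∙ (l ∙ m)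
∙-assoc ⟨ e , d , t ⟩ ⟨ e′ , d′ , t′ ⟩ ⟨ e″ , d″ , t″ ⟩
  rewrite xor-assoc e e′ e″ | +-assoc d d′ d″ | ⊔-assoc t t′ t″ = refl

∙-comm : ∀ k l → k ∙ l ≡ l ∙ k
∙-comm ⟨ e , d , t ⟩ ⟨ e′ , d′ , t′ ⟩
  rewrite xor-comm e e′ | +-comm d d′ | ⊔-comm t t′ = refl

∙-identityʳ : ∀ k → k ∙ ε ≡ k
∙-identityʳ ⟨ e , d , t ⟩
  rewrite xor-identityʳ e | +-identityʳ d | ⊔-identityʳ t = refl

shapeOf : Gen → Shape
shapeOf a     = ⟨ true  , 0 , 0 ⟩
shapeOf b     = ⟨ false , 1 , 0 ⟩
shapeOf (c n) = ⟨ false , suc (suc n) , suc n ⟩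

shape : Word → Shape
shape []      = ε
shape (g ∷ w) = shapeOf g ∙ shape w

shape-++ : ∀ x y → shape (x ++ y) ≡ shape x ∙ shape y
shape-++ []      y = refl
shape-++ (g ∷ x) y rewrite shape-++ x y = sym (∙-assoc (shapeOf g) (shape x) (shape y))

shape-b^ : ∀ k → shape (b^ k) ≡ ⟨ false , k , 0 ⟩
shape-b^ zero    = refl
shape-b^ (suc k) rewrite shape-b^ k = refl

shape-b^c : ∀ k n → shape (b^ k ++ c n ∷ []) ≡ ⟨ false , k + suc (suc n) , suc n ⟩
shape-b^c k n rewrite shape-++ (b^ k) (c n ∷ []) | shape-b^ k | +-identityʳ n = refl

-- Erasing the top index when the degree exceeds twice it: this is the relation
-- b^(n+1) c n = b^(2n+3), which absorbs c n into a power of b.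
collapse : Shape → Shape
collapse ⟨ e , d , t ⟩ with d ≤? t + t
... | yes _ = ⟨ e , d , t ⟩
... | no  _ = ⟨ e , d , 0 ⟩

collapse-kept : ∀ {e d t} → d ≤ t + t → collapse ⟨ e , d , t ⟩ ≡ ⟨ e , d , t ⟩
collapse-kept {d = d} {t} d≤ with d ≤? t + t
... | yes _ = refl
... | no d≰ = ⊥-elim (d≰ d≤)

collapse-dropped : ∀ {e d t} → t + t < d → collapse ⟨ e , d , t ⟩ ≡ ⟨ e , d , 0 ⟩
collapse-dropped {d = d} {t} <d with d ≤? t + t
... | yes d≤ = ⊥-elim (<⇒≱ <d d≤)
... | no _   = refl

collapse-untopped : ∀ e d → collapse ⟨ e , d , 0 ⟩ ≡ ⟨ e , d , 0 ⟩
collapse-untopped e d with d ≤? 0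
... | yes _ = refl
... | no  _ = refl

collapse-∙ˡ : ∀ k l → collapse (k ∙ l) ≡ collapse (collapse k ∙ l)
collapse-∙ˡ ⟨ e , d , t ⟩ ⟨ e′ , d′ , t′ ⟩ with d ≤? t + t
... | yes _ = refl
... | no d≰ with ≤-total t t′
...   | inj₁ t≤t′ rewrite m≤n⇒m⊔n≡n t≤t′ = refl
...   | inj₂ t′≤t rewrite m≥n⇒m⊔n≡m t′≤t =
  trans (collapse-dropped t+t<d+d′) (sym (collapse-dropped (≤-<-trans (+-mono-≤ t′≤t t′≤t) t+t<d+d′)))
  where
  t+t<d+d′ : t + t < d + d′
  t+t<d+d′ = <-≤-trans (≰⇒> d≰) (m≤m+n d d′)

collapse-∙ʳ : ∀ k l → collapse (k ∙ l) ≡ collapse (k ∙ collapse l)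
collapse-∙ʳ k l = begin
  collapse (k ∙ l)           ≡⟨ cong collapse (∙-comm k l) ⟩
  collapse (l ∙ k)           ≡⟨ collapse-∙ˡ l k ⟩
  collapse (collapse l ∙ k)  ≡⟨ cong collapse (∙-comm (collapse l) k) ⟩
  collapse (k ∙ collapse l)  ∎
  where open ≡-Reasoning

key : Word → Shape
key w = collapse (shape w)

key-++ˡ : ∀ x y → key (x ++ y) ≡ collapse (key x ∙ shape y)
key-++ˡ x y = trans (cong collapse (shape-++ x y)) (collapse-∙ˡ (shape x) (shape y))

key-++ : ∀ x y → key (x ++ y) ≡ collapse (key x ∙ key y)
key-++ x y = trans (key-++ˡ x y) (collapse-∙ʳ (key x) (shape y))

key-b^ : ∀ k → key (b^ k) ≡ ⟨ false , k , 0 ⟩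
key-b^ k rewrite shape-b^ k = collapse-untopped false k

key-cong : ∀ {x y} → x ≈Q y → key x ≡ key y
key-cong ≈refl         = refl
key-cong (≈sym p)      = sym (key-cong p)
key-cong (≈trans p q)  = trans (key-cong p) (key-cong q)
key-cong (≈cong {x} {x′} {y} {y′} p q) = begin
  key (x ++ y)               ≡⟨ key-++ x y ⟩
  collapse (key x ∙ key y)   ≡⟨ cong₂ (λ k l → collapse (k ∙ l)) (key-cong p) (key-cong q) ⟩
  collapse (key x′ ∙ key y′) ≡⟨ key-++ x′ y′ ⟨
  key (x′ ++ y′)             ∎
  where open ≡-Reasoning
key-cong (≈comm x y) rewrite shape-++ x y | shape-++ y x = cong collapse (∙-comm (shape x) (shape y))
key-cong rel-a = refl
key-cong (rel-b n) = begin
  collapse (shape (b^ (suc n) ++ c n ∷ []))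
    ≡⟨ cong collapse (shape-b^c (suc n) n) ⟩
  collapse ⟨ false , suc n + suc (suc n) , suc n ⟩
    ≡⟨ collapse-dropped (+-monoʳ-< (suc n) (n<1+n (suc n))) ⟩
  ⟨ false , suc n + suc (suc n) , 0 ⟩
    ≡⟨ cong (λ d → ⟨ false , d , 0 ⟩) (degree n) ⟩
  ⟨ false , 2 * n + 3 , 0 ⟩
    ≡⟨ key-b^ (2 * n + 3) ⟨
  key (b^ (2 * n + 3))
    ∎
  where
  open ≡-Reasoning
  degree : ∀ n → suc n + suc (suc n) ≡ 2 * n + 3
  degree = solve-∀
key-cong (rel-c m n m≤n)
  rewrite shape-b^c (m + 2) n | m≤n⇒m⊔n≡n m≤n | +-identityʳ n | +-comm m 2 = refl

Admissible : Shape → Set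
Admissible ⟨ _ , d , t ⟩ = cWeight t ≤ d

cWeight-⊔ : ∀ t t′ → cWeight (t ⊔ t′) ≡ cWeight t ⊔ cWeight t′
cWeight-⊔ zero    t′      = refl
cWeight-⊔ (suc t) zero    = refl
cWeight-⊔ (suc t) (suc t′) = refl

admissible-∙ : ∀ {k l} → Admissible k → Admissible l → Admissible (k ∙ l)
admissible-∙ {⟨ _ , d , t ⟩} {⟨ _ , d′ , t′ ⟩} ak al rewrite cWeight-⊔ t t′ =
  ⊔-lub (≤-trans ak (m≤m+n d d′)) (≤-trans al (m≤n+m d′ d))

admissible-shapeOf : ∀ g → Admissible (shapeOf g)
admissible-shapeOf a     = z≤n
admissible-shapeOf b     = z≤n
admissible-shapeOf (c n) = ≤-refl

admissible-shape : ∀ w → Admissible (shape w)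
admissible-shape []      = z≤n
admissible-shape (g ∷ w) = admissible-∙ {shapeOf g} {shape w} (admissible-shapeOf g) (admissible-shape w)

rep : Shape → Word
rep ⟨ e , d , t ⟩ = mono e (d ∸ cWeight t) t

rep-mono : ∀ e i t → rep ⟨ e , cWeight t + i , t ⟩ ≡ mono e i t
rep-mono e i t = cong (λ j → mono e j t) (m+n∸m≡n (cWeight t) i)

rep-∙-ordered : ∀ {k l} → Admissible k → Admissible l → Shape.top k ≤ Shape.top l →
  rep (k ∙ l) ≈Q rep k ++ rep l
rep-∙-ordered {⟨ e , _ , t ⟩} {⟨ e′ , _ , t′ ⟩} ak al t≤t′
  with m≤n⇒∃[o]m+o≡n ak | m≤n⇒∃[o]m+o≡n al
... | i , refl | j , refl = begin
  rep ⟨ e xor e′ , (cWeight t + i) + (cWeight t′ + j) , t ⊔ t′ ⟩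
    ≡⟨ cong₂ (λ d s → rep ⟨ e xor e′ , d , s ⟩)
             (degree (cWeight t) (cWeight t′) i j) (m≤n⇒m⊔n≡n t≤t′) ⟩
  rep ⟨ e xor e′ , cWeight t′ + (i + j + cWeight t) , t′ ⟩
    ≡⟨ rep-mono (e xor e′) (i + j + cWeight t) t′ ⟩
  mono (e xor e′) (i + j + cWeight t) t′
    ≈⟨ mono-++ e e′ i j t≤t′ ⟨
  mono e i t ++ mono e′ j t′
    ≡⟨ cong₂ _++_ (rep-mono e i t) (rep-mono e′ j t′) ⟨
  rep ⟨ e , cWeight t + i , t ⟩ ++ rep ⟨ e′ , cWeight t′ + j , t′ ⟩
    ∎
  where
  open ≈Q-Reasoning
  degree : ∀ w w′ i j → (w + i) + (w′ + j) ≡ w′ + (i + j + w)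
  degree = solve-∀

rep-∙ : ∀ {k l} → Admissible k → Admissible l → rep (k ∙ l) ≈Q rep k ++ rep l
rep-∙ {k} {l} ak al with ≤-total (Shape.top k) (Shape.top l)
... | inj₁ k≤l = rep-∙-ordered {k} {l} ak al k≤l
... | inj₂ l≤k = begin
  rep (k ∙ l)    ≡⟨ cong rep (∙-comm k l) ⟩
  rep (l ∙ k)    ≈⟨ rep-∙-ordered {l} {k} al ak l≤k ⟩
  rep l ++ rep k ≈⟨ ≈comm (rep l) (rep k) ⟩
  rep k ++ rep l ∎
  where open ≈Q-Reasoning

rep-shapeOf : ∀ g → rep (shapeOf g) ≈Q g ∷ []
rep-shapeOf a     = ≈refl
rep-shapeOf b     = ≈refl
rep-shapeOf (c n) = ≡⇒≈Q (cong (λ i → b^ i ++ c n ∷ []) (n∸n≡0 n))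

rep-shape : ∀ w → w ≈Q rep (shape w)
rep-shape []      = ≈refl
rep-shape (g ∷ w) = begin
  (g ∷ []) ++ w
    ≈⟨ ≈cong (≈sym (rep-shapeOf g)) (rep-shape w) ⟩
  rep (shapeOf g) ++ rep (shape w)
    ≈⟨ rep-∙ {shapeOf g} {shape w} (admissible-shapeOf g) (admissible-shape w) ⟨
  rep (shapeOf g ∙ shape w)
    ∎
  where open ≈Q-Reasoning

≤⇒≤-double : ∀ {i n} → i ≤ n → suc (suc n) + i ≤ suc n + suc n
≤⇒≤-double {i} {n} i≤n rewrite +-suc n n = s≤s (s≤s (+-monoʳ-≤ n i≤n))

≤-double⇒≤ : ∀ {i n} → suc (suc n) + i ≤ suc n + suc n → i ≤ n
≤-double⇒≤ {i} {n} h rewrite +-suc n n = +-cancelˡ-≤ n i n (≤-pred (≤-pred h))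

rep-collapse : ∀ {k} → Admissible k → rep k ≈Q rep (collapse k)
rep-collapse {⟨ e , d , zero ⟩} _ rewrite collapse-untopped e d = ≈refl
rep-collapse {⟨ e , d , suc n ⟩} ak with d ≤? suc n + suc n | m≤n⇒∃[o]m+o≡n ak
... | yes _  | _        = ≈refl
... | no d≰ | i , refl = begin
  rep ⟨ e , suc (suc n) + i , suc n ⟩  ≡⟨ rep-mono e i (suc n) ⟩
  a^ e ++ (b^ i ++ c n ∷ [])           ≈⟨ ≈Q-congˡ (a^ e) (b^-c-absorb n<i) ⟩
  a^ e ++ b^ (i + suc (suc n))         ≡⟨ cong (λ j → a^ e ++ b^ j) (+-comm i (suc (suc n))) ⟩
  a^ e ++ b^ (suc (suc n) + i)         ≡⟨ cong (a^ e ++_) (++-identityʳ _) ⟨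
  rep ⟨ e , suc (suc n) + i , 0 ⟩      ∎
  where
  open ≈Q-Reasoning
  n<i : n < i
  n<i = ≰⇒> (d≰ ∘ ≤⇒≤-double)

normalForm : ∀ w → w ≈Q rep (key w)
normalForm w = ≈trans (rep-shape w) (rep-collapse {shape w} (admissible-shape w))

≡key⇒≈Q : ∀ {x y} → key x ≡ key y → x ≈Q y
≡key⇒≈Q {x} {y} eq = ≈trans (normalForm x) (≈trans (≡⇒≈Q (cong rep eq)) (≈sym (normalForm y)))

Normal : Shape → Set
Normal ⟨ _ , d , zero  ⟩ = ⊤
Normal ⟨ _ , d , suc n ⟩ = suc (suc n) ≤ d × d ≤ suc n + suc n

normal-collapse : ∀ {k} → Admissible k → Normal (collapse k)
normal-collapse {⟨ e , d , zero ⟩} _ rewrite collapse-untopped e d = tt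
normal-collapse {⟨ e , d , suc n ⟩} ak with d ≤? suc n + suc n
... | yes d≤ = ak , d≤
... | no  _  = tt

key-normal : ∀ w → Normal (key w)
key-normal w = normal-collapse {shape w} (admissible-shape w)

collapse-normal : ∀ {k} → Normal k → collapse k ≡ k
collapse-normal {⟨ e , d , zero ⟩}  _        = collapse-untopped e d
collapse-normal {⟨ e , d , suc n ⟩} (_ , d≤) = collapse-kept d≤

isOdd : ℕ → Bool
isOdd zero    = false
isOdd (suc n) = not (isOdd n)

isOdd-+ : ∀ m n → isOdd (m + n) ≡ isOdd m xor isOdd n
isOdd-+ zero    n = refl
isOdd-+ (suc m) n rewrite isOdd-+ m n = not-distribˡ-xor (isOdd m) (isOdd n)

isOdd-double : ∀ n → isOdd (n + n) ≡ false
isOdd-double n = trans (isOdd-+ n n) (xor-same (isOdd n))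

isOdd-+2 : ∀ m n → isOdd (m + suc (suc n)) ≡ isOdd (m + n)
isOdd-+2 m n rewrite +-suc m (suc n) | +-suc m n = not-involutive (isOdd (m + n))

Odd⇒isOdd : ∀ {k} → Odd k → isOdd k ≡ true
Odd⇒isOdd (j , refl) rewrite +-identityʳ j | isOdd-double j = refl

isOdd⇒Odd : ∀ k → isOdd k ≡ true → Odd k
isOdd⇒Odd (suc zero)    _ = 0 , refl
isOdd⇒Odd (suc (suc k)) h with isOdd⇒Odd k (trans (sym (not-involutive (isOdd k))) h)
... | j , refl = suc j , double j
  where
  double : ∀ j → suc (suc (suc (2 * j))) ≡ suc (2 * suc j)
  double = solve-∀

-- Whether the normal form of a shape lies in P; b^m c n has degree m + n + 2.
member : Shape → Bool
member ⟨ true  , zero  , zero  ⟩ = true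
member ⟨ true  , _     , _     ⟩ = false
member ⟨ false , d     , suc _ ⟩ = isOdd d
member ⟨ false , zero  , zero  ⟩ = false
member ⟨ false , suc d , zero  ⟩ = isOdd d

InP-resp : ∀ {x y} → x ≈Q y → InP y → InP x
InP-resp x≈y (inj₁ y≈a) = inj₁ (≈trans x≈y y≈a)
InP-resp x≈y (inj₂ (inj₁ (m , 1≤m , y≈))) = inj₂ (inj₁ (m , 1≤m , ≈trans x≈y y≈))
InP-resp x≈y (inj₂ (inj₂ (m , n , m≤n , odd , y≈))) =
  inj₂ (inj₂ (m , n , m≤n , odd , ≈trans x≈y y≈))

InP⇒member : ∀ w → InP w → member (key w) ≡ true
InP⇒member w (inj₁ w≈a) = cong member (key-cong w≈a)
InP⇒member w (inj₂ (inj₁ (suc m , _ , w≈b))) = begin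
  member (key w)                         ≡⟨ cong member (trans (key-cong w≈b) (key-b^ (2 * suc m))) ⟩
  isOdd (m + suc (m + 0))                ≡⟨ cong isOdd (+-suc m (m + 0)) ⟩
  isOdd (suc (2 * m))                    ≡⟨ Odd⇒isOdd (m , refl) ⟩
  true                                   ∎
  where open ≡-Reasoning
InP⇒member w (inj₂ (inj₂ (m , n , m≤n , odd , w≈bc))) = begin
  member (key w)                                     ≡⟨ cong member (key-cong w≈bc) ⟩
  member (collapse (shape (b^ m ++ c n ∷ [])))       ≡⟨ cong (member ∘ collapse) (shape-b^c m n) ⟩
  member (collapse ⟨ false , m + suc (suc n) , suc n ⟩) ≡⟨ cong member (collapse-kept kept) ⟩
  isOdd (m + suc (suc n))                            ≡⟨ isOdd-+2 m n ⟩
  isOdd (m + n)                                      ≡⟨ Odd⇒isOdd odd ⟩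
  true                                               ∎
  where
  open ≡-Reasoning
  kept : m + suc (suc n) ≤ suc n + suc n
  kept = subst (_≤ suc n + suc n) (+-comm (suc (suc n)) m) (≤⇒≤-double m≤n)

rep-InP : ∀ k → Normal k → member k ≡ true → InP (rep k)
rep-InP ⟨ true  , zero  , zero  ⟩ _ _ = inj₁ ≈refl
rep-InP ⟨ false , suc d , zero  ⟩ _ odd with isOdd⇒Odd d odd
... | j , refl = inj₂ (inj₁ (suc j , s≤s z≤n , ≡⇒≈Q (trans (++-identityʳ _) (cong b^ (double j)))))
  where
  double : ∀ j → suc (suc (2 * j)) ≡ 2 * suc j
  double = solve-∀
rep-InP ⟨ false , d , suc n ⟩ (lo , hi) odd with m≤n⇒∃[o]m+o≡n lo
... | i , refl =
  inj₂ (inj₂ (i , n , ≤-double⇒≤ hi , isOdd⇒Odd (i + n) odd′ , ≡⇒≈Q (rep-mono false i (suc n))))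
  where
  odd′ : isOdd (i + n) ≡ true
  odd′ = trans (cong isOdd (+-comm i n)) (trans (sym (not-involutive (isOdd (n + i)))) odd)
rep-InP ⟨ true  , zero  , suc _ ⟩ _ ()
rep-InP ⟨ true  , suc _ , _     ⟩ _ ()
rep-InP ⟨ false , zero  , zero  ⟩ _ ()

InP⇔member : ∀ w → InP w ⇔ member (key w) ≡ true
InP⇔member w = mk⇔ (InP⇒member w) λ h → InP-resp (normalForm w) (rep-InP (key w) (key-normal w) h)

record Separated (k l : Shape) : Set where
  constructor separatedBy
  field
    word    : Word
    differs : member (collapse (k ∙ shape word)) ≢ member (collapse (l ∙ shape word))

Separated-sym : ∀ {k l} → Separated k l → Separated l k
Separated-sym (separatedBy z differs) = separatedBy z (differs ∘ sym)

separated-by : ∀ {k l} z {x y} → member (collapse (k ∙ shape z)) ≡ x →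
  member (collapse (l ∙ shape z)) ≡ y → x ≢ y → Separated k l
separated-by z kz≡x lz≡y x≢y = separatedBy z λ eq → x≢y (trans (sym kz≡x) (trans eq lz≡y))

∙-shapeOf-a : ∀ d t → ⟨ true , d , t ⟩ ∙ shapeOf a ≡ ⟨ false , d , t ⟩
∙-shapeOf-a d t rewrite +-identityʳ d | ⊔-identityʳ t = refl

separated-by-a : ∀ {k l} → Separated (k ∙ shapeOf a) (l ∙ shapeOf a) → Separated k l
separated-by-a {k} {l} (separatedBy z differs) =
  separatedBy (a ∷ z) (differs ∘ subst₂ _≡_ (regroup k) (regroup l))
  where
  regroup : ∀ k → member (collapse (k ∙ shape (a ∷ z))) ≡ member (collapse (k ∙ shapeOf a ∙ shape z))
  regroup k = cong (member ∘ collapse) (sym (∙-assoc k (shapeOf a) (shape z)))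

member-∙-[] : ∀ {k} → Normal k → member (collapse (k ∙ shape [])) ≡ member k
member-∙-[] {k} nk = cong member (trans (cong collapse (∙-identityʳ k)) (collapse-normal {k} nk))

∙-shape-c : ∀ e d t p → ⟨ e , d , t ⟩ ∙ shape (c p ∷ []) ≡ ⟨ e , d + suc (suc p) , t ⊔ suc p ⟩
∙-shape-c e d t p rewrite xor-identityʳ e | +-identityʳ p = refl

c-kept : ∀ {d p} t → d ≤ p → d + suc (suc p) ≤ (t ⊔ suc p) + (t ⊔ suc p)
c-kept {d} {p} t d≤p = begin
  d + suc (suc p)            ≤⟨ +-monoˡ-≤ (suc (suc p)) d≤p ⟩
  p + suc (suc p)            ≡⟨ +-suc p (suc p) ⟩
  suc p + suc p              ≤⟨ +-mono-≤ (m≤n⊔m t (suc p)) (m≤n⊔m t (suc p)) ⟩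
  (t ⊔ suc p) + (t ⊔ suc p)  ∎
  where open ≤-Reasoning

member-kept : ∀ {d T} → 0 < T → d ≤ T + T → member (collapse ⟨ false , d , T ⟩) ≡ isOdd d
member-kept {T = suc n} _ d≤ = cong member (collapse-kept d≤)

member-c-kept : ∀ d t p → d + suc (suc p) ≤ (t ⊔ suc p) + (t ⊔ suc p) →
  member (collapse (⟨ false , d , t ⟩ ∙ shape (c p ∷ []))) ≡ isOdd (d + p)
member-c-kept d t p kept = begin
  member (collapse (⟨ false , d , t ⟩ ∙ shape (c p ∷ [])))
    ≡⟨ cong (member ∘ collapse) (∙-shape-c false d t p) ⟩
  member (collapse ⟨ false , d + suc (suc p) , t ⊔ suc p ⟩)
    ≡⟨ member-kept (<-≤-trans z<s (m≤n⊔m t (suc p))) kept ⟩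
  isOdd (d + suc (suc p))
    ≡⟨ isOdd-+2 d p ⟩
  isOdd (d + p)
    ∎
  where open ≡-Reasoning

member-c-dropped : ∀ d t p → (t ⊔ suc p) + (t ⊔ suc p) < d + suc (suc p) →
  member (collapse (⟨ false , d , t ⟩ ∙ shape (c p ∷ []))) ≡ not (isOdd (d + p))
member-c-dropped d t p dropped = begin
  member (collapse (⟨ false , d , t ⟩ ∙ shape (c p ∷ [])))
    ≡⟨ cong (member ∘ collapse) (∙-shape-c false d t p) ⟩
  member (collapse ⟨ false , d + suc (suc p) , t ⊔ suc p ⟩)
    ≡⟨ cong member (collapse-dropped dropped) ⟩
  member ⟨ false , d + suc (suc p) , 0 ⟩
    ≡⟨ cong (λ d′ → member ⟨ false , d′ , 0 ⟩) (+-suc d (suc p)) ⟩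
  isOdd (d + suc p)
    ≡⟨ cong isOdd (+-suc d p) ⟩
  not (isOdd (d + p))
    ∎
  where open ≡-Reasoning

member-collapse-a : ∀ d t → member (collapse ⟨ true , suc d , t ⟩) ≡ false
member-collapse-a d t with suc d ≤? t + t
... | yes _ = refl
... | no  _ = refl

member-c-a : ∀ d t p → member (collapse (⟨ true , d , t ⟩ ∙ shape (c p ∷ []))) ≡ false
member-c-a d t p = begin
  member (collapse (⟨ true , d , t ⟩ ∙ shape (c p ∷ [])))
    ≡⟨ cong (member ∘ collapse) (∙-shape-c true d t p) ⟩
  member (collapse ⟨ true , d + suc (suc p) , t ⊔ suc p ⟩)
    ≡⟨ cong (λ d′ → member (collapse ⟨ true , d′ , t ⊔ suc p ⟩)) (+-suc d (suc p)) ⟩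
  member (collapse ⟨ true , suc (d + suc p) , t ⊔ suc p ⟩)
    ≡⟨ member-collapse-a (d + suc p) (t ⊔ suc p) ⟩
  false
    ∎
  where open ≡-Reasoning

isOdd-cancel : ∀ m n → isOdd (m + (m + n)) ≡ isOdd n
isOdd-cancel m n = begin
  isOdd (m + (m + n))         ≡⟨ cong isOdd (+-assoc m m n) ⟨
  isOdd (m + m + n)           ≡⟨ isOdd-+ (m + m) n ⟩
  isOdd (m + m) xor isOdd n   ≡⟨ cong (_xor isOdd n) (isOdd-double m) ⟩
  isOdd n                     ∎
  where open ≡-Reasoning

normal⇒admissible : ∀ {k} → Normal k → Admissible k
normal⇒admissible {⟨ _ , _ , zero ⟩}  _        = z≤n
normal⇒admissible {⟨ _ , _ , suc _ ⟩} (lo , _) = lo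

n≤cWeight : ∀ n → n ≤ cWeight n
n≤cWeight zero    = z≤n
n≤cWeight (suc n) = n≤1+n (suc n)

separate-degree-parity : ∀ {d t d′ t′} → isOdd d ≢ isOdd d′ →
  Separated ⟨ false , d , t ⟩ ⟨ false , d′ , t′ ⟩
separate-degree-parity {d} {t} {d′} {t′} parities = separated-by (c (d + d′) ∷ [])
  (trans (member-c-kept d t (d + d′) (c-kept t (m≤m+n d d′))) (isOdd-cancel d d′))
  (trans (member-c-kept d′ t′ (d + d′) (c-kept t′ (m≤n+m d′ d)))
         (trans (cong (λ s → isOdd (d′ + s)) (+-comm d d′)) (isOdd-cancel d′ d)))
  (parities ∘ sym)

-- For d′ = p + 1, multiplying by c p keeps a c-part on the left but collapses the
-- right-hand side to b^(2p+3), which is not in P.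
separate-degree : ∀ {d t d′ t′} → Admissible ⟨ false , d′ , t′ ⟩ → d < d′ → isOdd d ≡ isOdd d′ →
  Separated ⟨ false , d , t ⟩ ⟨ false , d′ , t′ ⟩
separate-degree {d} {t} {suc p} {t′} al (s≤s d≤p) parity = separated-by (c p ∷ [])
  (trans (member-c-kept d t p (c-kept t d≤p)) odd)
  (trans (member-c-dropped (suc p) t′ p dropped) (cong (not ∘ not) (isOdd-double p)))
  λ ()
  where
  odd : isOdd (d + p) ≡ true
  odd = trans (isOdd-+ d p) (trans (cong (_xor isOdd p) parity) (xor-inverseˡ (isOdd p)))
  dropped : (t′ ⊔ suc p) + (t′ ⊔ suc p) < suc p + suc (suc p)
  dropped rewrite m≤n⇒m⊔n≡n (≤-trans (n≤cWeight t′) al) = +-monoʳ-< (suc p) (n<1+n (suc p))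

separate-top-zero : ∀ {d n} → Normal ⟨ false , d , suc n ⟩ →
  Separated ⟨ false , d , 0 ⟩ ⟨ false , d , suc n ⟩
separate-top-zero {suc d} {n} nl = separated-by []
  (member-∙-[] {⟨ false , suc d , 0 ⟩} tt)
  (member-∙-[] {⟨ false , suc d , suc n ⟩} nl)
  (not-¬ refl)

-- p is chosen so that both products have degree 2(n′ + 1): the larger top index
-- survives, the smaller one collapses.
separate-top : ∀ {d n n′} → Normal ⟨ false , d , suc n ⟩ → Normal ⟨ false , d , suc n′ ⟩ → n < n′ →
  Separated ⟨ false , d , suc n ⟩ ⟨ false , d , suc n′ ⟩
separate-top {d} {n} {n′} (_ , d≤) (2+n′≤d , _) n<n′
  with m≤n⇒∃[o]m+o≡n (≤-trans d≤ (+-mono-≤ n<n′ n<n′))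
... | p , d+p≡ = separated-by (c p ∷ [])
  (trans (member-c-dropped d (suc n) p dropped) (cong not even))
  (trans (member-c-kept d (suc n′) p kept) even)
  λ ()
  where
  even : isOdd (d + p) ≡ false
  even = trans (cong isOdd d+p≡) (isOdd-double n′)
  p<n′ : p < n′
  p<n′ = +-cancelˡ-≤ n′ (suc p) n′ (begin
    n′ + suc p        ≡⟨ +-suc n′ p ⟩
    suc (n′ + p)      ≤⟨ n≤1+n (suc (n′ + p)) ⟩
    suc (suc n′) + p  ≤⟨ +-monoˡ-≤ p 2+n′≤d ⟩
    d + p             ≡⟨ d+p≡ ⟩
    n′ + n′           ∎)
    where open ≤-Reasoning
  dropped : (suc n ⊔ suc p) + (suc n ⊔ suc p) < d + suc (suc p)
  dropped = begin-strict
    (suc n ⊔ suc p) + (suc n ⊔ suc p)  ≤⟨ +-mono-≤ (⊔-lub n<n′ p<n′) (⊔-lub n<n′ p<n′) ⟩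
    n′ + n′                            ≡⟨ d+p≡ ⟨
    d + p                              <⟨ +-monoʳ-< d (m<n+m p {2} z<s) ⟩
    d + suc (suc p)                    ∎
    where open ≤-Reasoning
  kept : d + suc (suc p) ≤ (suc n′ ⊔ suc p) + (suc n′ ⊔ suc p)
  kept = begin
    d + suc (suc p)                    ≡⟨ +-suc d (suc p) ⟩
    suc (d + suc p)                    ≡⟨ cong suc (+-suc d p) ⟩
    suc (suc (d + p))                  ≡⟨ cong (suc ∘ suc) d+p≡ ⟩
    suc (suc (n′ + n′))                ≡⟨ cong suc (+-suc n′ n′) ⟨
    suc n′ + suc n′
      ≤⟨ +-mono-≤ (m≤m⊔n (suc n′) (suc p)) (m≤m⊔n (suc n′) (suc p)) ⟩
    (suc n′ ⊔ suc p) + (suc n′ ⊔ suc p) ∎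
    where open ≤-Reasoning

separate-same-degree : ∀ {d t t′} → Normal ⟨ false , d , t ⟩ → Normal ⟨ false , d , t′ ⟩ → t < t′ →
  Separated ⟨ false , d , t ⟩ ⟨ false , d , t′ ⟩
separate-same-degree {t = zero}  {suc _} _  nl _           = separate-top-zero nl
separate-same-degree {t = suc _} {suc _} nk nl (s≤s n<n′) = separate-top nk nl n<n′

separate-a-even : ∀ {d t d′ t′} → Normal ⟨ false , d , t ⟩ → Normal ⟨ false , d′ , t′ ⟩ →
  ⟨ false , d , t ⟩ ≢ ⟨ false , d′ , t′ ⟩ → Separated ⟨ false , d , t ⟩ ⟨ false , d′ , t′ ⟩
separate-a-even {d} {t} {d′} {t′} nk nl k≢l with isOdd d ≟ᵇ isOdd d′ | <-cmp d d′
... | no parities | _ = separate-degree-parity parities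
... | yes parity  | tri< d<d′ _ _ =
  separate-degree (normal⇒admissible {⟨ false , d′ , t′ ⟩} nl) d<d′ parity
... | yes parity  | tri> _ _ d′<d =
  Separated-sym (separate-degree (normal⇒admissible {⟨ false , d , t ⟩} nk) d′<d (sym parity))
... | yes _       | tri≈ _ refl _ with <-cmp t t′
...   | tri< t<t′ _ _ = separate-same-degree nk nl t<t′
...   | tri≈ _ refl _ = ⊥-elim (k≢l refl)
...   | tri> _ _ t′<t = Separated-sym (separate-same-degree nl nk t′<t)

separate-a-parity : ∀ d t d′ t′ → Separated ⟨ false , d , t ⟩ ⟨ true , d′ , t′ ⟩
separate-a-parity d t d′ t′ = separated-by (c (suc d) ∷ [])
  (trans (member-c-kept d t (suc d) (c-kept t (n≤1+n d))) odd)
  (member-c-a d′ t′ (suc d))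
  λ ()
  where
  odd : isOdd (d + suc d) ≡ true
  odd = trans (cong isOdd (+-suc d d)) (cong not (isOdd-double d))

normal-parity : ∀ {e e′ d} t → Normal ⟨ e , d , t ⟩ → Normal ⟨ e′ , d , t ⟩
normal-parity zero    _ = tt
normal-parity (suc _) n = n

separate : ∀ {k l} → Normal k → Normal l → k ≢ l → Separated k l
separate {⟨ false , _ , _ ⟩} {⟨ false , _ , _ ⟩} nk nl k≢l = separate-a-even nk nl k≢l
separate {⟨ false , d , t ⟩} {⟨ true , d′ , t′ ⟩} _ _ _ = separate-a-parity d t d′ t′
separate {⟨ true , d , t ⟩} {⟨ false , d′ , t′ ⟩} _ _ _ = Separated-sym (separate-a-parity d′ t′ d t)
separate {⟨ true , d , t ⟩} {⟨ true , d′ , t′ ⟩} nk nl k≢l =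
  separated-by-a (subst₂ Separated (sym (∙-shapeOf-a d t)) (sym (∙-shapeOf-a d′ t′))
    (separate-a-even (normal-parity t nk) (normal-parity t′ nl)
      (k≢l ∘ cong (λ k → record k { parity = true }))))

open Equivalence using (to; from)

exactly-one : ∀ {P Q : Set} {p q : Bool} → P ⇔ p ≡ true → Q ⇔ q ≡ true → p ≢ q →
  (P × ¬ Q) ⊎ (¬ P × Q)
exactly-one {p = true}  {true}  _  _  p≢q = ⊥-elim (p≢q refl)
exactly-one {p = false} {false} _  _  p≢q = ⊥-elim (p≢q refl)
exactly-one {p = true}  {false} P⇔ Q⇔ _   = inj₁ (from P⇔ refl , λ q → case to Q⇔ q of λ ())
exactly-one {p = false} {true}  P⇔ Q⇔ _   = inj₂ ((λ p → case to P⇔ p of λ ()) , from Q⇔ refl)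

separated⇒distinguishable : ∀ x y → Separated (key x) (key y) → Distinguishable _++_ InP x y
separated⇒distinguishable x y (separatedBy z differs) =
  z , exactly-one (InP⇔member (x ++ z)) (InP⇔member (y ++ z))
        (differs ∘ subst₂ _≡_ (cong member (key-++ˡ x z)) (cong member (key-++ˡ y z)))

mainTheorem2 : Reduced _≈Q_ _++_ InP
mainTheorem2 x y x≉y =
  separated⇒distinguishable x y (separate (key-normal x) (key-normal y) (x≉y ∘ ≡key⇒≈Q))
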